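{- Let $\varphi$ be an LTL formula over the variables $V_i = I_i \cup O_i$ of a process $p_i$, and let $\mathcal{A}_\varphi$ be an alternating co-Büchi automaton with $\mathcal{L}(\mathcal{A}_\varphi) = \mathcal{L}(\varphi)$. Let $s$ be a strategy for $p_i$. If $s$ is delay-dominant for $\mathcal{A}_\varphi$, then $s$ is remorsefree dominant for $\varphi$.
   Context: An alternating co-Büchi automaton (ACA) $\mathcal{A}=(Q,q_0,\delta,F)$ over a finite set of variables $\Sigma$ has a finite state set $Q$, initial state $q_0\in Q$, rejecting states $F\subseteq Q$, and a transition function $\delta: Q\times 2^\Sigma\to\mathbb{B}^+(Q)$ into positive Boolean formulas over $Q$, given in disjunctive normal form and identified with a set of sets: $\delta(q,a)=\{c_1,\dots,c_k\}$ with $c_m\subseteq Q$ stands for $\bigvee_m\bigwedge_{q'\in c_m} q'$. A run tree on $\sigma\in(2^\Sigma)^\omega$ is a $Q$-labeled tree $(\mathcal{T},\ell)$ with $\ell(\varepsilon)=q_0$ and, for every node $x$, $\{\ell(x')\mid x' \text{ a child of } x\}\in\delta(\ell(x),\sigma_{|x|})$. It is accepting if every infinite branch visits only finitely many states of $F$; $\mathcal{A}$ accepts $\sigma$ if some run tree on $\sigma$ is accepting; $\mathcal{L}(\mathcal{A})$ is the set of accepted words. A process $p_i$ has disjoint finite sets of input variables $I_i$ and output variables $O_i$; $V_i=I_i\cup O_i$. A strategy $s$ for $p_i$ is a function $(2^{I_i})^*\to 2^{O_i}$ represented by a finite Moore machine $(T,t_0,\tau,o)$ with $\tau:T\times 2^{I_i}\to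 T$ and $o:T\to 2^{O_i}$. On $\gamma\in(2^{I_i})^\omega$ it visits $t_0t_1\dots$ with $t_{j+1}=\tau(t_j,\gamma_j)$, and its computation is $\mathit{comp}(s,\gamma)=(\gamma_0\cup o(t_0))(\gamma_1\cup o(t_1))\dots\in(2^{V_i})^\omega$. Delay-dominance game $(\mathcal{A},\sigma,\sigma')$ for an ACA $\mathcal{A}=(Q,q_0,\delta,F)$ and $\sigma,\sigma'\in(2^{V_i})^\omega$: a two-player game between Duplicator (player 0) and Spoiler (player 1). Spoiler owns positions $((p,q),j)$ and $((p,q,c,c'),j)$; Duplicator owns positions $((p,q,c),j)$ and $((p,q,c,q'),j)$. Here $p,q,q'\in Q$, $c,c'\subseteq Q$, $j\in\mathbb{N}$. The moves are: - $((p,q),j)\to((p,q,c),j)$ for $c\in\delta(p,\sigma_j)$; - $((p,q,c),j)\to((p,q,c,c'),j)$ for $c'\in\delta(q,\sigma'_j)$; - $((p,q,c,c'),j)\to((p,q,c,q'),j)$ for $q'\in c'$; - $((p,q,c,q'),j)\to((p',q'),j+1)$ for $p'\in c$. The initial position is $((q_0,q_0),0)$. In a position, $p$ is the alternative state and $q$ the dominant state. A play $\rho$ is won by Duplicator iff for every index $k$, if the dominant state of $\rho_k$ is in $F$, then there is $k'\ge k$ such that the alternative state of $\rho_{k'}$ is in $F$. A strategy of Duplicator is winning if every play from the initial position consistent with it is won by Duplicator. For strategies $s,t$ of $p_i$ and an input sequence $\gamma$, $s$ delay-dominates $t$ on $\gamma$ for $\mathcal{A}$ if Duplicator has a winning strategy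 in the game $(\mathcal{A},\mathit{comp}(t,\gamma),\mathit{comp}(s,\gamma))$. $s$ delay-dominates $t$ if this holds for all $\gamma\in(2^{I_i})^\omega$. $s$ is delay-dominant for $\mathcal{A}$ (and $p_i$) if it delay-dominates every strategy $t$ for $p_i$. A strategy $s$ for $p_i$ is remorsefree dominant for $\varphi$ if, for every strategy $t$ for $p_i$ and every $\gamma\in(2^{I_i})^\omega$, $\mathit{comp}(t,\gamma)\models\varphi$ implies $\mathit{comp}(s,\gamma)\models\varphi$. -}

module Defs where

open import Data.Nat using (ℕ; zero; suc; _≤_; _<_)
open import Data.Fin using (Fin)
open import Data.Bool using (Bool; true; false)
open import Data.Sum using (_⊎_; [_,_])
open import Data.Product using (Σ; ∃; ∃-syntax; _×_; _,_)
open import Data.List using (List; []; _∷_; map; upTo; length)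
open import Data.List.Membership.Propositional using (_∈_)
open import Relation.Binary.PropositionalEquality using (_≡_)
open import Relation.Nullary using (¬_)

Letter : Set → Set
Letter V = V → Bool

Word : Set → Set
Word V = ℕ → Letter V

data LTL (V : Set) : Set where
  tt   : LTL V
  var  : V → LTL V
  ¬ₗ_  : LTL V → LTL V
  _∧ₗ_ : LTL V → LTL V → LTL V
  _∨ₗ_ : LTL V → LTL V → LTL V
  Xₗ_  : LTL V → LTL V
  _Uₗ_ : LTL V → LTL V → LTL V

Sat : {V : Set} → Word V → ℕ → LTL V → Set
Sat σ j tt = Data.Unit.⊤ where import Data.Unit
Sat σ j (var v) = σ j v ≡ true
Sat σ j (¬ₗ φ) = ¬ Sat σ j φ
Sat σ j (φ ∧ₗ ψ) = Sat σ j φ × Sat σ j ψ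
Sat σ j (φ ∨ₗ ψ) = Sat σ j φ ⊎ Sat σ j ψ
Sat σ j (Xₗ φ) = Sat σ (suc j) φ
Sat σ j (φ Uₗ ψ) = ∃[ k ] (j ≤ k × Sat σ k ψ × (∀ m → j ≤ m → m < k → Sat σ m φ))

_⊨_ : {V : Set} → Word V → LTL V → Set
σ ⊨ φ = Sat σ 0 φ

-- Alternating co-Büchi automata with state set Fin nQ.
-- δ q a is a DNF, given as a list of clauses (each clause a list of states,
-- read as a set).

record ACA (V : Set) : Set where
  field
    nQ : ℕ
    q₀ : Fin nQ
    δ  : Fin nQ → Letter V → List (List (Fin nQ))
    F  : Fin nQ → Bool     -- rejecting states

SameSet : {A : Set} → List A → List A → Set
SameSet {A} l₁ l₂ = ∀ (a : A) → (a ∈ l₁ → a ∈ l₂) × (a ∈ l₂ → a ∈ l₁)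

-- Tree nodes are addresses (lists of child indices, most recent first):
-- the i-th child of node x is (i ∷ x); the depth of x is length x.
data InTree (arity : List ℕ → ℕ) : List ℕ → Set where
  root  : InTree arity []
  child : ∀ {x i} → InTree arity x → i < arity x → InTree arity (i ∷ x)

path : (ℕ → ℕ) → ℕ → List ℕ
path b zero = []
path b (suc k) = b k ∷ path b k

module _ {V : Set} (A : ACA V) where
  open ACA A

  record RunTree (σ : Word V) : Set where
    field
      lab   : List ℕ → Fin nQ
      arity : List ℕ → ℕ
      lab-root : lab [] ≡ q₀
      valid : ∀ x → InTree arity x →
              Σ (List (Fin nQ)) λ c →
                c ∈ δ (lab x) (σ (length x)) ×
                SameSet (map (λ i → lab (i ∷ x)) (upTo (arity x))) c

  AcceptingRun : {σ : Word V} → RunTree σ → Set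
  AcceptingRun r = ∀ (b : ℕ → ℕ) → (∀ k → b k < arity (path b k)) →
                   ∃[ N ] (∀ k → N ≤ k → F (lab (path b k)) ≡ false)
    where open RunTree r

  Accepts : Word V → Set
  Accepts σ = Σ (RunTree σ) AcceptingRun

SameLanguage : {V : Set} → ACA V → LTL V → Set
SameLanguage {V} A φ = ∀ (σ : Word V) → (Accepts A σ → σ ⊨ φ) × (σ ⊨ φ → Accepts A σ)

-- Processes: inputs I = Fin ni, outputs O = Fin no, V = I ⊎ O.
-- Strategies are finite Moore machines.

record Strategy (ni no : ℕ) : Set where
  field
    nT  : ℕ
    t₀  : Fin nT
    τ   : Fin nT → Letter (Fin ni) → Fin nT
    out : Fin nT → Letter (Fin no)

module _ {ni no : ℕ} (s : Strategy ni no) where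
  open Strategy s

  stateAt : Word (Fin ni) → ℕ → Fin nT
  stateAt γ zero = t₀
  stateAt γ (suc j) = τ (stateAt γ j) (γ j)

  comp : Word (Fin ni) → Word (Fin ni ⊎ Fin no)
  comp γ j = [ γ j , out (stateAt γ j) ]

module Game {V : Set} (A : ACA V) (σ σ' : Word V) where
  open ACA A

  Q = Fin nQ

  data Pos : Set where
    sp₀ : (p q : Q) → ℕ → Pos
    du₁ : (p q : Q) → List Q → ℕ → Pos
    sp₂ : (p q : Q) → List Q → List Q → ℕ → Pos
    du₃ : (p q : Q) → List Q → Q → ℕ → Pos

  data Move : Pos → Pos → Set where
    mv₀ : ∀ {p q c j} → c ∈ δ p (σ j) → Move (sp₀ p q j) (du₁ p q c j)
    mv₁ : ∀ {p q c c' j} → c' ∈ δ q (σ' j) → Move (du₁ p q c j) (sp₂ p q c c' j)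
    mv₂ : ∀ {p q c c' q' j} → q' ∈ c' → Move (sp₂ p q c c' j) (du₃ p q c q' j)
    mv₃ : ∀ {p q c q' p' j} → p' ∈ c → Move (du₃ p q c q' j) (sp₀ p' q' (suc j))

  isDup : Pos → Bool
  isDup (sp₀ _ _ _) = false
  isDup (du₁ _ _ _ _) = true
  isDup (sp₂ _ _ _ _ _) = false
  isDup (du₃ _ _ _ _ _) = true

  alt : Pos → Q
  alt (sp₀ p _ _) = p
  alt (du₁ p _ _ _) = p
  alt (sp₂ p _ _ _ _) = p
  alt (du₃ p _ _ _ _) = p

  dom : Pos → Q
  dom (sp₀ _ q _) = q
  dom (du₁ _ q _ _) = q
  dom (sp₂ _ q _ _ _) = q
  dom (du₃ _ q _ _ _) = q

  initial : Pos
  initial = sp₀ q₀ q₀ 0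

  -- Duplicator strategies: functions from histories (most recent position first) to positions
  DupStrategy : Set
  DupStrategy = List Pos → Pos

  hist : (ℕ → Pos) → ℕ → List Pos
  hist ρ zero = ρ 0 ∷ []
  hist ρ (suc k) = ρ (suc k) ∷ hist ρ k

  ConsistentUpTo : DupStrategy → (ℕ → Pos) → ℕ → Set
  ConsistentUpTo f ρ k =
    ρ 0 ≡ initial ×
    (∀ i → i < k → Move (ρ i) (ρ (suc i)) ×
                   (isDup (ρ i) ≡ true → ρ (suc i) ≡ f (hist ρ i)))

  WonByDuplicator : (ℕ → Pos) → Set
  WonByDuplicator ρ = ∀ k → F (dom (ρ k)) ≡ true →
                      ∃[ k' ] (k ≤ k' × F (alt (ρ k')) ≡ true)

  -- A winning strategy never gets Duplicator stuck on a consistent play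
  -- (a player unable to move loses), and every infinite consistent play is won.
  Winning : DupStrategy → Set
  Winning f =
    (∀ ρ k → ConsistentUpTo f ρ k → isDup (ρ k) ≡ true → Move (ρ k) (f (hist ρ k))) ×
    (∀ ρ → (∀ k → ConsistentUpTo f ρ k) → WonByDuplicator ρ)

  DuplicatorWins : Set
  DuplicatorWins = Σ DupStrategy Winning

module _ {ni no : ℕ} where
  DelayDominates : ACA (Fin ni ⊎ Fin no) → Strategy ni no → Strategy ni no → Word (Fin ni) → Set
  DelayDominates A s t γ = Game.DuplicatorWins A (comp t γ) (comp s γ)

  DelayDominant : ACA (Fin ni ⊎ Fin no) → Strategy ni no → Set
  DelayDominant A s = ∀ (t : Strategy ni no) (γ : Word (Fin ni)) → DelayDominates A s t γ

  RemorsefreeDominant : LTL (Fin ni ⊎ Fin no) → Strategy ni no → Set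
  RemorsefreeDominant φ s = ∀ (t : Strategy ni no) (γ : Word (Fin ni)) →
                            comp t γ ⊨ φ → comp s γ ⊨ φ

{-# OPTIONS --safe #-}
module Submission where

open import Defs
open import Data.Nat using (ℕ; zero; suc; _≤_; _<_; _*_; _+_; _/_; _%_; s≤s)
open import Data.Nat.Properties using (≤-refl; ≤-trans; <-≤-trans; <-irrefl; m≤n⇒m≤1+n; m<1+n⇒m<n∨m≡n; m≤m*n; _≟_)
open import Data.Nat.DivMod using (m≡m%n+[m/n]*n; m%n<n; m*n/n≡m; /-monoˡ-≤)
open import Data.Fin using (Fin)
import Data.Fin.Properties as Fin
open import Data.Bool using (true; false)
open import Data.Bool.Properties using (¬-not)
open import Data.Sum using (_⊎_; inj₁; inj₂)
open import Data.Product using (Σ; _×_; _,_; proj₁; proj₂)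
open import Data.List using (List; []; _∷_; map; upTo; length; applyUpTo)
open import Data.List.Properties using (map-upTo)
open import Data.List.Membership.Propositional using (_∈_; find)
open import Data.List.Membership.Propositional.Properties using (∈-upTo⁻)
open import Data.List.Relation.Unary.Any using (Any; here; there; any?)
import Data.List.Relation.Unary.Any as Any
import Data.List.Relation.Unary.Any.Properties as Any
open import Function using (_∘_)
open import Relation.Binary.PropositionalEquality
open import Relation.Nullary using (yes; no)

-- From Duplicator's winning strategy and an accepting run tree of A on the
-- word of t, Spoiler builds a run tree on the word of s: at each node Spoiler
-- plays the alternative state along a branch of the given run (its clause, then
-- the child carrying the state Duplicator picks), while the children of the new
-- node are Spoiler's possible picks from Duplicator's clause for the dominant
-- state.  Every branch of the new tree is a play consistent with the winning
-- strategy, shadowed by a branch of the given run; a rejecting dominant state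
-- would force a later rejecting alternative state on that accepting branch.

lookupOr : {A : Set} → List A → ℕ → A → A
lookupOr []       i       d = d
lookupOr (a ∷ as) zero    d = a
lookupOr (a ∷ as) (suc i) d = lookupOr as i d

lookupOr-∈ : {A : Set} (as : List A) {i : ℕ} (d : A) → i < length as → lookupOr as i d ∈ as
lookupOr-∈ (a ∷ as) {zero}  d _        = here refl
lookupOr-∈ (a ∷ as) {suc i} d (s≤s i<) = there (lookupOr-∈ as d i<)

map-lookupOr-upTo : {A : Set} (as : List A) (d : A) →
                    map (λ i → lookupOr as i d) (upTo (length as)) ≡ as
map-lookupOr-upTo as d = trans (map-upTo _ (length as)) (applyUpTo-lookupOr as)
  where
  applyUpTo-lookupOr : ∀ as → applyUpTo (λ i → lookupOr as i d) (length as) ≡ as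
  applyUpTo-lookupOr []       = refl
  applyUpTo-lookupOr (a ∷ as) = cong (a ∷_) (applyUpTo-lookupOr as)

≡⇒SameSet : {A : Set} {l₁ l₂ : List A} → l₁ ≡ l₂ → SameSet l₁ l₂
≡⇒SameSet l₁≡l₂ a = subst (a ∈_) l₁≡l₂ , subst (a ∈_) (sym l₁≡l₂)

m*4≤n⇒m≤n/4 : ∀ {m n} → m * 4 ≤ n → m ≤ n / 4
m*4≤n⇒m≤n/4 {m} {n} m*4≤n = subst (_≤ n / 4) (m*n/n≡m m 4) (/-monoˡ-≤ 4 m*4≤n)

childIndex : List ℕ → ℕ
childIndex []      = 0
childIndex (i ∷ _) = i

length-path : ∀ b k → length (path b k) ≡ k
length-path b zero    = refl
length-path b (suc k) = cong suc (length-path b k)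

path-cong : ∀ {b b′} n → (∀ {k} → k < n → b k ≡ b′ k) → path b n ≡ path b′ n
path-cong zero    b≡b′ = refl
path-cong (suc n) b≡b′ = cong₂ _∷_ (b≡b′ ≤-refl) (path-cong n (b≡b′ ∘ m≤n⇒m≤1+n))

-- Any branch through the node x; beyond the depth of x it is arbitrary.
branchThrough : List ℕ → ℕ → ℕ
branchThrough []      k = 0
branchThrough (i ∷ x) k with k ≟ length x
... | yes _ = i
... | no  _ = branchThrough x k

path-branchThrough : ∀ x → path (branchThrough x) (length x) ≡ x
path-branchThrough []      = refl
path-branchThrough (i ∷ x) =
  cong₂ _∷_ top (trans (path-cong (length x) below) (path-branchThrough x))
  where
  top : branchThrough (i ∷ x) (length x) ≡ i
  top with length x ≟ length x
  ... | yes _ = refl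
  ... | no  ≢ with () ← ≢ refl
  below : ∀ {k} → k < length x → branchThrough (i ∷ x) k ≡ branchThrough x k
  below {k} k< with k ≟ length x
  ... | yes refl with () ← <-irrefl refl k<
  ... | no  _    = refl

InTree-path⇒< : ∀ {ar b} n → InTree ar (path b n) → ∀ {k} → k < n → b k < ar (path b k)
InTree-path⇒< (suc n) (child x∈ b<) k<1+n with m<1+n⇒m<n∨m≡n k<1+n
... | inj₁ k<n  = InTree-path⇒< n x∈ k<n
... | inj₂ refl = b<

InTree-child⇒< : ∀ {ar i x} → InTree ar (i ∷ x) → i < ar x
InTree-child⇒< (child _ i<) = i<

module _ {V : Set} (A : ACA V) (σ σ′ : Word V) where
  open ACA A
  open Game A σ σ′

  roundOf : Pos → ℕ
  roundOf (sp₀ _ _ j)     = j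
  roundOf (du₁ _ _ _ j)   = j
  roundOf (sp₂ _ _ _ _ j) = j
  roundOf (du₃ _ _ _ _ j) = j

  dominantClause : Pos → List Q
  dominantClause (sp₂ _ _ _ c′ _) = c′
  dominantClause _                = []

  du₁-move : ∀ {p q c j X} → Move (du₁ p q c j) X →
             X ≡ sp₂ p q c (dominantClause X) j × dominantClause X ∈ δ q (σ′ j)
  du₁-move (mv₁ c′∈) = refl , c′∈

  du₃-move : ∀ {p q c q′ j X} → Move (du₃ p q c q′ j) X →
             X ≡ sp₀ (alt X) q′ (suc j) × alt X ∈ c
  du₃-move (mv₃ p′∈) = refl , p′∈

  ConsistentUpTo-suc : ∀ {g ρ n} → ConsistentUpTo g ρ n → Move (ρ n) (ρ (suc n)) →
                       (isDup (ρ n) ≡ true → ρ (suc n) ≡ g (hist ρ n)) → ConsistentUpTo g ρ (suc n)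
  ConsistentUpTo-suc {n = n} (start , moves) mv follows = start , moves′
    where
    moves′ : ∀ i → i < suc n → _
    moves′ i i< with m<1+n⇒m<n∨m≡n i<
    ... | inj₁ i<n  = moves i i<n
    ... | inj₂ refl = mv , follows

  ConsistentUpTo-≤ : ∀ {g ρ n n′} → n ≤ n′ → ConsistentUpTo g ρ n′ → ConsistentUpTo g ρ n
  ConsistentUpTo-≤ n≤n′ (start , moves) = start , λ i i< → moves i (<-≤-trans i< n≤n′)

  LegalMoves : DupStrategy → Set
  LegalMoves f = ∀ ρ k → ConsistentUpTo f ρ k → isDup (ρ k) ≡ true → Move (ρ k) (f (hist ρ k))

  module Simulation (r : RunTree A σ) (f : DupStrategy) (legal : LegalMoves f) where
    open RunTree r

    record Config : Set where
      constructor config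
      field
        pos   : Pos
        past  : List Pos
        node  : List ℕ
        node∈ : InTree arity node
    open Config

    history : Config → List Pos
    history s = pos s ∷ past s

    clauseAt : (y : List ℕ) → InTree arity y → List Q
    clauseAt y y∈ = proj₁ (valid y y∈)

    -- Stays at y when no child carries p; this never happens on plays
    -- consistent with a winning strategy.
    childLabelled : (y : List ℕ) → InTree arity y → Q → Σ (List ℕ) (InTree arity)
    childLabelled y y∈ p with any? (λ i → lab (i ∷ y) Fin.≟ p) (upTo (arity y))
    ... | yes ∃i = let (i , i∈ , _) = find ∃i in i ∷ y , child y∈ (∈-upTo⁻ i∈)
    ... | no  _  = y , y∈

    childLabelled-spec : ∀ y y∈ p → Any (λ i → lab (i ∷ y) ≡ p) (upTo (arity y)) →
                         let y′ = proj₁ (childLabelled y y∈ p) in lab y′ ≡ p × y′ ≡ childIndex y′ ∷ y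
    childLabelled-spec y y∈ p ∃i with any? (λ i → lab (i ∷ y) Fin.≟ p) (upTo (arity y))
    ... | yes ∃i′ = proj₂ (proj₂ (find ∃i′)) , refl
    ... | no  ∄i  with () ← ∄i ∃i

    -- Spoiler's moves use the run node for the alternative state and the
    -- index i for the dominant state; Duplicator's answers are read off f.
    step : ℕ → Config → Config
    step i (config (sp₀ p q j) past y y∈) =
      config (du₁ p q (clauseAt y y∈) j) (sp₀ p q j ∷ past) y y∈
    step i (config (du₁ p q c j) past y y∈) =
      config (sp₂ p q c (dominantClause (f (du₁ p q c j ∷ past))) j) (du₁ p q c j ∷ past) y y∈
    step i (config (sp₂ p q c c′ j) past y y∈) =
      config (du₃ p q c (lookupOr c′ i q) j) (sp₂ p q c c′ j ∷ past) y y∈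
    step i (config (du₃ p q c q′ j) past y y∈) =
      config (sp₀ (alt (f (du₃ p q c q′ j ∷ past))) q′ (suc j)) (du₃ p q c q′ j ∷ past)
             (proj₁ (childLabelled y y∈ (alt (f (du₃ p q c q′ j ∷ past)))))
             (proj₂ (childLabelled y y∈ (alt (f (du₃ p q c q′ j ∷ past)))))

    past-step : ∀ i s → past (step i s) ≡ history s
    past-step i (config (sp₀ _ _ _) _ _ _)     = refl
    past-step i (config (du₁ _ _ _ _) _ _ _)   = refl
    past-step i (config (sp₂ _ _ _ _ _) _ _ _) = refl
    past-step i (config (du₃ _ _ _ _ _) _ _ _) = refl

    round : ℕ → Config → Config
    round i = step i ∘ step i ∘ step i ∘ step i

    duplicatorClause : Config → List Q
    duplicatorClause s = dominantClause (pos (step 0 (step 0 s)))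

    data RoundStart : Config → ℕ → Set where
      roundStart : ∀ {p q past y k} (y∈ : InTree arity y) → RoundStart (config (sp₀ p q k) past y y∈) k

    atNode : List ℕ → Config
    atNode []      = config initial [] [] root
    atNode (i ∷ x) = round i (atNode x)

    label′ : List ℕ → Q
    label′ x = dom (pos (atNode x))

    arity′ : List ℕ → ℕ
    arity′ x = length (duplicatorClause (atNode x))

    module Along (b : ℕ → ℕ) where
      next : Config → Config
      next s = step (b (roundOf (pos s))) s

      next⁴ : Config → Config
      next⁴ = next ∘ next ∘ next ∘ next

      play : ℕ → Config
      play zero    = atNode []
      play (suc n) = next (play n)

      ρ : ℕ → Pos
      ρ n = pos (play n)

      hist-ρ : ∀ n → hist ρ n ≡ history (play n)
      hist-ρ zero    = refl
      hist-ρ (suc n) = cong (ρ (suc n) ∷_) (trans (hist-ρ n) (sym (past-step _ (play n))))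

      next⁴-roundStart : ∀ {s k} → RoundStart s k → RoundStart (next⁴ s) (suc k)
      next⁴-roundStart (roundStart _) = roundStart _

      round≡next⁴ : ∀ {s k} → RoundStart s k → round (b k) s ≡ next⁴ s
      round≡next⁴ (roundStart _) = refl

      roundStart-play : ∀ k → RoundStart (play (k * 4)) k
      roundStart-play zero    = roundStart root
      roundStart-play (suc k) = next⁴-roundStart (roundStart-play k)

      atNode-path : ∀ k → atNode (path b k) ≡ play (k * 4)
      atNode-path zero    = refl
      atNode-path (suc k) = trans (cong (round (b k)) (atNode-path k)) (round≡next⁴ (roundStart-play k))

      LegalStep : Config → Set
      LegalStep s = Move (pos s) (pos (next s)) × (isDup (pos s) ≡ true → pos (next s) ≡ f (history s))

      ConsistentUpTo-next : ∀ {n} → ConsistentUpTo f ρ n → LegalStep (play n) → ConsistentUpTo f ρ (suc n)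
      ConsistentUpTo-next {n} cons (mv , follows) =
        ConsistentUpTo-suc {f} cons mv (λ dup → trans (follows dup) (cong f (sym (hist-ρ n))))

      DuplicatorMove : Config → Set
      DuplicatorMove s = Move (pos s) (f (history s))

      legal-play : ∀ {n} → ConsistentUpTo f ρ n → isDup (ρ n) ≡ true → DuplicatorMove (play n)
      legal-play {n} cons dup = subst (Move (ρ n) ∘ f) (hist-ρ n) (legal ρ n cons dup)

      -- The branch of r that the alternative states follow.
      rBranch : ℕ → ℕ
      rBranch k = childIndex (node (play (suc k * 4)))

      record Invariant (k : ℕ) : Set where
        field
          consistent : ConsistentUpTo f ρ (k * 4)
          p q        : Q
          past₀      : List Pos
          y          : List ℕ
          y∈         : InTree arity y
          play≡      : play (k * 4) ≡ config (sp₀ p q k) past₀ y y∈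
          lab-y      : lab y ≡ p
          y≡         : y ≡ path rBranch k

      module Round {k} (I : Invariant k) where
        open Invariant I

        s₀ : Config
        s₀ = config (sp₀ p q k) past₀ y y∈

        forth : (P : Config → Set) → P s₀ → P (play (k * 4))
        forth P = subst P (sym play≡)

        back : (P : Config → Set) → P (play (k * 4)) → P s₀
        back P = subst P play≡

        C : List Q
        C = clauseAt y y∈

        C∈δ : C ∈ δ p (σ k)
        C∈δ = subst₂ (λ a j → C ∈ δ a (σ j)) lab-y (trans (cong length y≡) (length-path rBranch k))
                     (proj₁ (proj₂ (valid y y∈)))

        consistent₁ : ConsistentUpTo f ρ (1 + k * 4)
        consistent₁ = ConsistentUpTo-next consistent (forth LegalStep (mv₀ C∈δ , λ ()))

        move₁ : DuplicatorMove (next s₀)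
        move₁ = back (DuplicatorMove ∘ next) (legal-play consistent₁ (forth (λ s → isDup (pos (next s)) ≡ true) refl))

        C′ : List Q
        C′ = duplicatorClause s₀

        duplicatorClause∈δ : C′ ∈ δ q (σ′ k)
        duplicatorClause∈δ = proj₂ (du₁-move move₁)

        consistent₂ : ConsistentUpTo f ρ (2 + k * 4)
        consistent₂ = ConsistentUpTo-next consistent₁
          (forth (LegalStep ∘ next) (mv₁ duplicatorClause∈δ , λ _ → sym (proj₁ (du₁-move move₁))))

        module _ (b<C′ : b k < length C′) where
          consistent₃ : ConsistentUpTo f ρ (3 + k * 4)
          consistent₃ = ConsistentUpTo-next consistent₂
            (forth (LegalStep ∘ next ∘ next) (mv₂ (lookupOr-∈ C′ q b<C′) , λ ()))

          move₃ : DuplicatorMove (next (next (next s₀)))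
          move₃ = back (DuplicatorMove ∘ next ∘ next ∘ next)
            (legal-play consistent₃ (forth (λ s → isDup (pos (next (next (next s)))) ≡ true) refl))

          P′ : Q
          P′ = alt (f (history (next (next (next s₀)))))

          consistent₄ : ConsistentUpTo f ρ (suc k * 4)
          consistent₄ = ConsistentUpTo-next consistent₃
            (forth (LegalStep ∘ next ∘ next ∘ next) (mv₃ (proj₂ (du₃-move move₃)) , λ _ → sym (proj₁ (du₃-move move₃))))

          P′-child : Any (λ i → lab (i ∷ y) ≡ P′) (upTo (arity y))
          P′-child = Any.map sym (Any.map⁻ (proj₂ (proj₂ (proj₂ (valid y y∈)) P′) (proj₂ (du₃-move move₃))))

          y′ : List ℕ
          y′ = proj₁ (childLabelled y y∈ P′)

          lab-y′ : lab y′ ≡ P′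
          lab-y′ = proj₁ (childLabelled-spec y y∈ P′ P′-child)

          y′≡ : y′ ≡ childIndex y′ ∷ y
          y′≡ = proj₂ (childLabelled-spec y y∈ P′ P′-child)

          invariant-suc : Invariant (suc k)
          invariant-suc = record
            { consistent = consistent₄
            ; play≡      = cong next⁴ play≡
            ; lab-y      = lab-y′
            ; y≡         = trans y′≡ (cong₂ _∷_ (cong (childIndex ∘ node ∘ next⁴) (sym play≡)) y≡)
            }

      invariant : ∀ d → (∀ {k} → k < d → b k < arity′ (path b k)) → Invariant d
      invariant zero    _  = record { consistent = refl , λ _ () ; play≡ = refl ; lab-y = lab-root ; y≡ = refl }
      invariant (suc d) b< = Round.invariant-suc I
        (subst (λ s → b d < length (duplicatorClause s)) (trans (atNode-path d) (Invariant.play≡ I)) (b< ≤-refl))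
        where I = invariant d (b< ∘ m≤n⇒m≤1+n)

      alt-duringRound : ∀ {k} → Invariant k → ∀ o → o < 4 → alt (ρ (o + k * 4)) ≡ lab (path rBranch k)
      alt-duringRound {k} I o o<4 = trans (alt≡p o o<4) (trans (sym lab-y) (cong lab y≡))
        where
        open Invariant I
        alt≡p : ∀ o → o < 4 → alt (ρ (o + k * 4)) ≡ p
        alt≡p 0 _ = cong (alt ∘ pos) play≡
        alt≡p 1 _ = cong (alt ∘ pos ∘ next) play≡
        alt≡p 2 _ = cong (alt ∘ pos ∘ next ∘ next) play≡
        alt≡p 3 _ = cong (alt ∘ pos ∘ next ∘ next ∘ next) play≡
        alt≡p (suc (suc (suc (suc _)))) (s≤s (s≤s (s≤s (s≤s ()))))

    valid′ : ∀ x → InTree arity′ x → Σ (List Q) λ c → c ∈ δ (label′ x) (σ′ (length x)) ×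
             SameSet (map (λ i → label′ (i ∷ x)) (upTo (arity′ x))) c
    valid′ x x∈ = duplicatorClause (atNode x) , proj₁ atNode-x-ok , ≡⇒SameSet (proj₂ atNode-x-ok)
      where
      open Along (branchThrough x)
      I : Invariant (length x)
      I = invariant (length x) (InTree-path⇒< (length x) (subst (InTree arity′) (sym (path-branchThrough x)) x∈))

      Ok : Config → Set
      Ok s = duplicatorClause s ∈ δ (dom (pos s)) (σ′ (length x)) ×
             map (λ i → dom (pos (round i s))) (upTo (length (duplicatorClause s))) ≡ duplicatorClause s

      atNode-x-ok : Ok (atNode x)
      atNode-x-ok = subst Ok (sym (trans (cong atNode (sym (path-branchThrough x)))
                                         (trans (atNode-path (length x)) (Invariant.play≡ I))))
                      (Round.duplicatorClause∈δ I , map-lookupOr-upTo (Round.C′ I) (Invariant.q I))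

    runTree : RunTree A σ′
    runTree = record { lab = label′ ; arity = arity′ ; lab-root = refl ; valid = valid′ }

    module _ (won : ∀ ρ → (∀ k → ConsistentUpTo f ρ k) → WonByDuplicator ρ)
             (r-accepting : AcceptingRun A r) where

      runTree-accepting : AcceptingRun A runTree
      runTree-accepting b b< = N , label′-accepting
        where
        open Along b
        I : ∀ k → Invariant k
        I k = invariant k (λ {k′} _ → b< k′)

        consistent : ∀ n → ConsistentUpTo f ρ n
        consistent n = ConsistentUpTo-≤ {f} (m≤m*n n 4) (Invariant.consistent (I n))

        rBranch< : ∀ k → rBranch k < arity (path rBranch k)
        rBranch< k = InTree-child⇒< (subst (InTree arity) (Invariant.y≡ (I (suc k))) (Invariant.y∈ (I (suc k))))

        N : ℕ
        N = proj₁ (r-accepting rBranch rBranch<)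

        alt-ρ : ∀ n → alt (ρ n) ≡ lab (path rBranch (n / 4))
        alt-ρ n = begin
          alt (ρ n)                    ≡⟨ cong (alt ∘ ρ) (m≡m%n+[m/n]*n n 4) ⟩
          alt (ρ (n % 4 + n / 4 * 4))  ≡⟨ alt-duringRound (I (n / 4)) (n % 4) (m%n<n n 4) ⟩
          lab (path rBranch (n / 4))   ∎
          where open ≡-Reasoning

        -- A rejecting dominant state would be answered by a rejecting
        -- alternative state in a later round, i.e. on the accepting branch of r.
        dom-accepting : ∀ k → N ≤ k → F (dom (ρ (k * 4))) ≢ true
        dom-accepting k N≤k rejecting with won ρ consistent (k * 4) rejecting
        ... | n , k*4≤n , alt-rejecting with ()
          ← trans (sym alt-rejecting) (trans (cong F (alt-ρ n))
                  (proj₂ (r-accepting rBranch rBranch<) (n / 4) (≤-trans N≤k (m*4≤n⇒m≤n/4 k*4≤n))))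

        label′-accepting : ∀ k → N ≤ k → F (label′ (path b k)) ≡ false
        label′-accepting k N≤k = ¬-not (subst (λ s → F (dom (pos s)) ≢ true) (sym (atNode-path k)) (dom-accepting k N≤k))

  DuplicatorWins⇒Accepts : DuplicatorWins → Accepts A σ → Accepts A σ′
  DuplicatorWins⇒Accepts (f , legal , won) (r , r-accepting) =
    runTree , runTree-accepting won r-accepting
    where open Simulation r f legal

theorem5 : (ni no : ℕ) (φ : LTL (Fin ni ⊎ Fin no)) (A : ACA (Fin ni ⊎ Fin no)) →
    SameLanguage A φ → (s : Strategy ni no) →
    DelayDominant A s → RemorsefreeDominant φ s
theorem5 _ _ φ A L[A]≡L[φ] s s-dominant t γ t⊨φ =
  proj₁ (L[A]≡L[φ] (comp s γ))
        (DuplicatorWins⇒Accepts A (comp t γ) (comp s γ) (s-dominant t γ) (proj₂ (L[A]≡L[φ] (comp t γ)) t⊨φ))
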